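{- Let $V$ be a finite set and let $S$ be a game on $V$ with at least two powerful voters. Then $S$ is the median $m(S_1,S_2,S_3)$ of three games $S_1,S_2,S_3$ on $V$, each having strictly more dummies than $S$. Moreover, if $S$ is strong (respectively simple, respectively strong and simple), then $S_1,S_2,S_3$ can be chosen to be strong (respectively simple, respectively strong and simple) as well.
   Context: A game on a finite set $V$ is a family $S$ of subsets of $V$ (winning coalitions) that is upward closed. $S$ is strong if for every $A\subseteq V$, $A\in S$ or $V\setminus A\in S$; simple if no $A$ has both $A\in S$ and $V\setminus A\in S$. A voter $v\in V$ is a dummy of $S$ if $v$ belongs to no minimal winning coalition of $S$; otherwise $v$ is powerful. The median of three games $S,T,U$ on $V$ is $m(S,T,U)=(S\cap T)\cup(S\cap U)\cup(T\cap U)$. -}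

module Defs where

open import Data.Nat using (ℕ; _<_)
open import Data.Bool using (Bool; true; false; _∧_; _∨_)
open import Data.Fin using (Fin)
open import Data.Fin.Subset using (Subset; _∈_; _∉_; _⊆_; ∁; ∣_∣)
open import Data.Product using (_×_; Σ; ∃; ∃-syntax)
open import Data.Sum using (_⊎_)
open import Relation.Nullary using (¬_)
open import Relation.Binary.PropositionalEquality using (_≡_; _≢_)
open import Function.Bundles using (_⇔_)

-- The finite voter set V is Fin n; coalitions are subsets of Fin n.
-- A family of coalitions is given by its (Boolean) membership function.
Family : ℕ → Set
Family n = Subset n → Bool

Wins : ∀ {n} → Family n → Subset n → Set
Wins S A = S A ≡ true

IsGame : ∀ {n} → Family n → Set
IsGame {n} S = ∀ (A B : Subset n) → A ⊆ B → Wins S A → Wins S B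

IsStrong : ∀ {n} → Family n → Set
IsStrong {n} S = ∀ (A : Subset n) → Wins S A ⊎ Wins S (∁ A)

IsSimple : ∀ {n} → Family n → Set
IsSimple {n} S = ∀ (A : Subset n) → ¬ (Wins S A × Wins S (∁ A))

MinimalWinning : ∀ {n} → Family n → Subset n → Set
MinimalWinning {n} S A = Wins S A × (∀ (B : Subset n) → B ⊆ A → Wins S B → B ≡ A)

Dummy : ∀ {n} → Family n → Fin n → Set
Dummy {n} S v = ∀ (A : Subset n) → MinimalWinning S A → v ∉ A

Powerful : ∀ {n} → Family n → Fin n → Set
Powerful S v = ¬ Dummy S v

IsDummySet : ∀ {n} → Family n → Subset n → Set
IsDummySet {n} S D = ∀ (v : Fin n) → (v ∈ D) ⇔ Dummy S v

MoreDummies : ∀ {n} → Family n → Family n → Set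
MoreDummies {n} T S = ∀ (D E : Subset n) → IsDummySet S D → IsDummySet T E → ∣ D ∣ < ∣ E ∣

median : ∀ {n} → Family n → Family n → Family n → Family n
median S T U A = (S A ∧ T A) ∨ (S A ∧ U A) ∨ (T A ∧ U A)

_≐_ : ∀ {n} → Family n → Family n → Set
_≐_ {n} S T = ∀ (A : Subset n) → S A ≡ T A

-- Write S⟨u≔v⟩ for the game in which voter u casts v's vote.  For a game S and a coalition A,
-- one of S⟨v≔w⟩ A and S⟨w≔v⟩ A equals S A: if A_v ≠ A_w one substitution adds a voter and the
-- other removes one, and by monotonicity S A lies between the two results.  Since two of A_u,
-- A_v, A_w agree, S = m(S⟨u≔v⟩, S⟨v≔w⟩, S⟨w≔u⟩) for any three voters; when all three are
-- powerful, each of these games keeps the dummies of S and gains one, and substitution commutes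
-- with complementation.  If u and v are the only powerful voters, S A is a monotone Boolean
-- function of A_u and A_v depending on both, hence equals m(A_u, A_v, c) for a constant c,
-- which is true when S is strong and false when S is simple.
module Submission where

open import Defs
open import Data.Nat using (ℕ)
open import Data.Bool using (Bool; true; false; not; _∧_; _∨_; _≤_; b≤b; f≤t)
open import Data.Bool.Properties
  using (≤-minimum; ≤-maximum; ≤-reflexive; ≤-antisym; ∨-identityʳ; ¬-not)
  renaming (_≟_ to _≟ᵇ_)
open import Data.Fin using (Fin; zero; suc)
open import Data.Fin.Properties using (_≟_; any?)
open import Data.Fin.Subset using (Subset; _∈_; _∉_; _⊆_; _⊂_; ∁; _-_) renaming (⊥ to ∅)
open import Data.Fin.Subset.Properties
  using (⊆-refl; ⊆-trans; ⊆-antisym; _∈?_; p⊂q⇒∣p∣<∣q∣; x∈p⇒p-x⊂p; x∈p∧x≢y⇒x∈p-y; p─q⊆p; anySubset?)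
open import Data.Fin.Subset.Induction using (⊂-wellFounded)
open import Data.Vec using ([]; _∷_; lookup; _[_]≔_)
open import Data.Vec.Properties
  using ([]=⇒lookup; lookup⇒[]=; lookup∘update; lookup∘update′; []≔-lookup; []≔-idempotent;
         []≔-commutes; map-[]≔; lookup-map)
open import Data.Product using (_×_; ∃-syntax; _,_; proj₁)
open import Data.Sum using (_⊎_; inj₁; inj₂; [_,_]′; swap)
open import Data.Empty using (⊥-elim)
open import Function using (id; _∘_)
open import Function.Bundles using (Equivalence)
open import Induction.WellFounded using (Acc; acc)
open import Relation.Nullary using (¬_; Dec; yes; no; contradiction; ¬?)
open import Relation.Nullary.Decidable using (_×-dec_; decidable-stable)
open import Relation.Binary.PropositionalEquality
  using (_≡_; refl; sym; trans; cong; cong₂; subst; subst₂; _≢_; ≢-sym; module ≡-Reasoning)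

private
  variable
    n : ℕ
    S T : Family n

maj : Bool → Bool → Bool → Bool
maj x y z = (x ∧ y) ∨ (x ∧ z) ∨ (y ∧ z)

maj-rotate : ∀ x y z → maj x y z ≡ maj y z x
maj-rotate false false false = refl
maj-rotate false false true  = refl
maj-rotate false true  false = refl
maj-rotate false true  true  = refl
maj-rotate true  false false = refl
maj-rotate true  false true  = refl
maj-rotate true  true  false = refl
maj-rotate true  true  true  = refl

maj-absorb : ∀ {s x y} → x ≡ s ⊎ y ≡ s → maj s x y ≡ s
maj-absorb {true}          (inj₁ refl) = refl
maj-absorb {false}         (inj₁ refl) = refl
maj-absorb {true}  {true}  (inj₂ refl) = refl
maj-absorb {true}  {false} (inj₂ refl) = refl
maj-absorb {false} {true}  (inj₂ refl) = refl
maj-absorb {false} {false} (inj₂ refl) = refl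

two-of-three-agree : ∀ (a b c : Bool) → a ≡ b ⊎ b ≡ c ⊎ c ≡ a
two-of-three-agree true  true  _     = inj₁ refl
two-of-three-agree false false _     = inj₁ refl
two-of-three-agree true  false true  = inj₂ (inj₂ refl)
two-of-three-agree true  false false = inj₂ (inj₁ refl)
two-of-three-agree false true  true  = inj₂ (inj₁ refl)
two-of-three-agree false true  false = inj₂ (inj₂ refl)

≤-sandwich : ∀ {x s y} → x ≤ s → s ≤ y → x ≡ s ⊎ y ≡ s
≤-sandwich b≤b _   = inj₁ refl
≤-sandwich f≤t b≤b = inj₂ refl

implies⇒≤ : ∀ {x y} → (x ≡ true → y ≡ true) → x ≤ y
implies⇒≤ {false} _ = ≤-minimum _
implies⇒≤ {true}  h = ≤-reflexive (sym (h refl))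

monotone-essential-table : ∀ {x₀₀ x₀₁ x₁₀ x₁₁} →
  x₀₀ ≤ x₁₀ → x₀₁ ≤ x₁₁ → x₀₀ ≤ x₀₁ → x₁₀ ≤ x₁₁ →
  ¬ (x₀₀ ≡ x₁₀ × x₀₁ ≡ x₁₁) → ¬ (x₀₀ ≡ x₀₁ × x₁₀ ≡ x₁₁) →
  x₀₀ ≡ false × x₁₁ ≡ true × x₀₁ ≡ x₁₀
monotone-essential-table b≤b b≤b _   _   ¬first _       = ⊥-elim (¬first (refl , refl))
monotone-essential-table f≤t b≤b f≤t b≤b _      _       = refl , refl , refl
monotone-essential-table b≤b f≤t b≤b f≤t _      _       = refl , refl , refl
monotone-essential-table f≤t f≤t b≤b b≤b _      ¬second = ⊥-elim (¬second (refl , refl))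

monotone-essential⇒maj : (G : Bool → Bool → Bool) →
  (∀ b → G false b ≤ G true b) → (∀ a → G a false ≤ G a true) →
  ¬ (∀ b → G false b ≡ G true b) → ¬ (∀ a → G a false ≡ G a true) →
  ∀ a b → G a b ≡ maj a b (G true false)
monotone-essential⇒maj G mono₁ mono₂ ess₁ ess₂ = table
  where
  facts : G false false ≡ false × G true true ≡ true × G false true ≡ G true false
  facts = monotone-essential-table (mono₁ false) (mono₁ true) (mono₂ false) (mono₂ true)
    (λ (e₀ , e₁) → ess₁ λ { false → e₀ ; true → e₁ })
    (λ (e₀ , e₁) → ess₂ λ { false → e₀ ; true → e₁ })
  table : ∀ a b → G a b ≡ maj a b (G true false)
  table false false = let e , _ , _ = facts in e
  table true  true  = let _ , e , _ = facts in e
  table false true  = let _ , _ , e = facts in e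
  table true  false = sym (∨-identityʳ _)

lookup-≤⇒⊆ : ∀ {A B : Subset n} → (∀ x → lookup A x ≤ lookup B x) → A ⊆ B
lookup-≤⇒⊆ {B = B} h {x} x∈A =
  lookup⇒[]= x B (≤-antisym (≤-maximum _) (subst (_≤ lookup B x) ([]=⇒lookup x∈A) (h x)))

⊆⇒lookup-≤ : ∀ {A B : Subset n} → A ⊆ B → ∀ x → lookup A x ≤ lookup B x
⊆⇒lookup-≤ {A = A} {B} A⊆B x = implies⇒≤ (λ e → []=⇒lookup (A⊆B (lookup⇒[]= x A e)))

lookup-∁ : ∀ (A : Subset n) x → lookup (∁ A) x ≡ not (lookup A x)
lookup-∁ A x = lookup-map x not A

∁-[]≔-lookup : ∀ (A : Subset n) u v → ∁ (A [ u ]≔ lookup A v) ≡ ∁ A [ u ]≔ lookup (∁ A) v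
∁-[]≔-lookup A u v = trans (map-[]≔ not A u) (cong (∁ A [ u ]≔_) (sym (lookup-∁ A v)))

[]≔-unchanged : ∀ (A : Subset n) i {b} → lookup A i ≡ b → A [ i ]≔ b ≡ A
[]≔-unchanged A i e = trans (cong (A [ i ]≔_) (sym e)) ([]≔-lookup A i)

[]≔-mono-⊆ : ∀ {A B : Subset n} {i b c} → A ⊆ B → b ≤ c → A [ i ]≔ b ⊆ B [ i ]≔ c
[]≔-mono-⊆ {A = A} {B} {i} {b} {c} A⊆B b≤c = lookup-≤⇒⊆ pointwise
  where
  pointwise : ∀ x → lookup (A [ i ]≔ b) x ≤ lookup (B [ i ]≔ c) x
  pointwise x with x ≟ i
  ... | yes refl = subst₂ _≤_ (sym (lookup∘update i A b)) (sym (lookup∘update i B c)) b≤c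
  ... | no x≢i rewrite lookup∘update′ x≢i A b | lookup∘update′ x≢i B c = ⊆⇒lookup-≤ A⊆B x

[]≔false-⊆ : ∀ (A : Subset n) i → A [ i ]≔ false ⊆ A
[]≔false-⊆ A i = subst (A [ i ]≔ false ⊆_) ([]≔-lookup A i) ([]≔-mono-⊆ ⊆-refl (≤-minimum _))

⊆-[]≔true : ∀ (A : Subset n) i → A ⊆ A [ i ]≔ true
⊆-[]≔true A i = subst (_⊆ A [ i ]≔ true) ([]≔-lookup A i) ([]≔-mono-⊆ ⊆-refl (≤-maximum _))

∉⇒⊆-[]≔false : ∀ {B A : Subset n} {t} → t ∉ B → B ⊆ A [ t ]≔ true → B ⊆ A [ t ]≔ false
∉⇒⊆-[]≔false {A = A} {t} t∉B B⊆A {x} x∈B with x ≟ t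
... | yes refl = contradiction x∈B t∉B
... | no x≢t = lookup⇒[]= x _
  (trans (lookup∘update′ x≢t A false) (trans (sym (lookup∘update′ x≢t A true)) ([]=⇒lookup (B⊆A x∈B))))

-- Games, dummies and independence

game-mono : IsGame S → ∀ {A B} → A ⊆ B → S A ≤ S B
game-mono g {A} {B} A⊆B = implies⇒≤ (g A B A⊆B)

minimal-winning-⊆ : IsGame S → ∀ X → Wins S X → ∃[ B ] (B ⊆ X × MinimalWinning S B)
minimal-winning-⊆ {S = S} g X = go X (⊂-wellFounded X)
  where
  go : ∀ X → Acc _⊂_ X → Wins S X → ∃[ B ] (B ⊆ X × MinimalWinning S B)
  go X (acc rec) wins with any? (λ x → (x ∈? X) ×-dec (S (X - x) ≟ᵇ true))
  ... | yes (x , x∈X , wins-x) =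
    let B , B⊆ , minimal = go (X - x) (rec (x∈p⇒p-x⊂p x∈X)) wins-x
    in B , ⊆-trans B⊆ (p─q⊆p X _) , minimal
  ... | no ¬removable = X , ⊆-refl , wins , minimal
    where
    minimal : ∀ B → B ⊆ X → Wins S B → B ≡ X
    minimal B B⊆X winsB = ⊆-antisym B⊆X X⊆B
      where
      X⊆B : X ⊆ B
      X⊆B {x} x∈X with x ∈? B
      ... | yes x∈B = x∈B
      ... | no  x∉B = ⊥-elim (¬removable (x , x∈X , g B (X - x) B⊆X-x winsB))
        where
        B⊆X-x : B ⊆ X - x
        B⊆X-x y∈B = x∈p∧x≢y⇒x∈p-y (B⊆X y∈B) λ { refl → x∉B y∈B }

Independent : Family n → Fin n → Set
Independent S t = ∀ A → S (A [ t ]≔ true) ≡ S (A [ t ]≔ false)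

independent⇒dummy : ∀ {t} → Independent S t → Dummy S t
independent⇒dummy {S = S} {t} ind A (wins , minimal) t∈A =
  contradiction (subst (t ∈_) (sym A-t≡A) t∈A) t∉A-t
  where
  A-t≡A : A [ t ]≔ false ≡ A
  A-t≡A = minimal _ ([]≔false-⊆ A t)
    (trans (sym (ind A)) (trans (cong S ([]≔-unchanged A t ([]=⇒lookup t∈A))) wins))
  t∉A-t : t ∉ A [ t ]≔ false
  t∉A-t t∈ = contradiction (trans (sym (lookup∘update t A false)) ([]=⇒lookup t∈)) λ ()

dummy⇒independent : IsGame S → ∀ {t} → Dummy S t → Independent S t
dummy⇒independent {S = S} g {t} dummy A =
  ≤-antisym (implies⇒≤ drop-t) (game-mono g ([]≔-mono-⊆ ⊆-refl (≤-minimum _)))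
  where
  drop-t : Wins S (A [ t ]≔ true) → Wins S (A [ t ]≔ false)
  drop-t wins =
    let B , B⊆ , minimalB = minimal-winning-⊆ g _ wins
    in g B _ (∉⇒⊆-[]≔false (dummy B minimalB) B⊆) (proj₁ minimalB)

independent? : (S : Family n) (t : Fin n) → Dec (Independent S t)
independent? S t with anySubset? (λ A → ¬? (S (A [ t ]≔ true) ≟ᵇ S (A [ t ]≔ false)))
... | yes (A , A-sensitive) = no (λ ind → A-sensitive (ind A))
... | no ¬sensitive =
  yes (λ A → decidable-stable (_ ≟ᵇ _) (λ A-sensitive → ¬sensitive (A , A-sensitive)))

dummy⇒≢-powerful : ∀ {t u} → Powerful S u → Dummy S t → t ≢ u
dummy⇒≢-powerful powerful dummy refl = powerful dummy

more-dummies : (∀ x → Dummy S x → Dummy T x) → ∀ {z} → Dummy T z → Powerful S z → MoreDummies T S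
more-dummies keeps {z} z-dummy z-powerful D E D-dummies E-dummies =
  p⊂q⇒∣p∣<∣q∣ (D⊆E , z , Equivalence.from (E-dummies z) z-dummy , z-powerful ∘ Equivalence.to (D-dummies z))
  where
  D⊆E : D ⊆ E
  D⊆E {x} x∈D = Equivalence.from (E-dummies x) (keeps x (Equivalence.to (D-dummies x) x∈D))

differ-only-on-independent⇒≡ : ∀ (S : Family n) A B →
  (∀ t → lookup A t ≢ lookup B t → Independent S t) → S A ≡ S B
differ-only-on-independent⇒≡ S []      []      _ = refl
differ-only-on-independent⇒≡ S (a ∷ A) (b ∷ B) h =
  trans (differ-only-on-independent⇒≡ (λ X → S (a ∷ X)) A B (λ t ne X → h (suc t) ne (a ∷ X)))
        (head a b (h zero))
  where
  head : ∀ a b → (a ≢ b → Independent S zero) → S (a ∷ B) ≡ S (b ∷ B)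
  head true  true  _   = refl
  head false false _   = refl
  head true  false ind = ind (λ ()) (true ∷ B)
  head false true  ind = sym (ind (λ ()) (true ∷ B))

Reduct : Family n → Family n → Set
Reduct S T = IsGame T × MoreDummies T S × (IsStrong S → IsStrong T) × (IsSimple S → IsSimple T)

MedianDecomposition : Family n → Set
MedianDecomposition S = ∃[ S₁ ] ∃[ S₂ ] ∃[ S₃ ]
  ( (IsGame S₁ × IsGame S₂ × IsGame S₃)
  × (S ≐ median S₁ S₂ S₃)
  × (MoreDummies S₁ S × MoreDummies S₂ S × MoreDummies S₃ S)
  × (IsStrong S → IsStrong S₁ × IsStrong S₂ × IsStrong S₃)
  × (IsSimple S → IsSimple S₁ × IsSimple S₂ × IsSimple S₃) )

median-decomposition : ∀ {S₁ S₂ S₃ : Family n} →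
  Reduct S S₁ → Reduct S S₂ → Reduct S S₃ → S ≐ median S₁ S₂ S₃ → MedianDecomposition S
median-decomposition {S₁ = S₁} {S₂} {S₃}
  (game₁ , more₁ , strong₁ , simple₁) (game₂ , more₂ , strong₂ , simple₂)
  (game₃ , more₃ , strong₃ , simple₃) S≐m =
  S₁ , S₂ , S₃ , (game₁ , game₂ , game₃) , S≐m , (more₁ , more₂ , more₃) ,
  (λ st → strong₁ st , strong₂ st , strong₃ st) , (λ si → simple₁ si , simple₂ si , simple₃ si)

-- Substituting one voter's vote by another's

_⟨_≔_⟩ : Family n → Fin n → Fin n → Family n
(S ⟨ u ≔ v ⟩) A = S (A [ u ]≔ lookup A v)

module _ {S : Family n} where

  ≔-game : IsGame S → ∀ u v → IsGame (S ⟨ u ≔ v ⟩)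
  ≔-game g u v A B A⊆B = g _ _ ([]≔-mono-⊆ A⊆B (⊆⇒lookup-≤ A⊆B v))

  ≔-strong : IsStrong S → ∀ u v → IsStrong (S ⟨ u ≔ v ⟩)
  ≔-strong st u v A =
    subst (λ X → Wins S (A [ u ]≔ lookup A v) ⊎ Wins S X) (∁-[]≔-lookup A u v) (st _)

  ≔-simple : IsSimple S → ∀ u v → IsSimple (S ⟨ u ≔ v ⟩)
  ≔-simple si u v A (wins , wins∁) = si _ (wins , subst (Wins S) (sym (∁-[]≔-lookup A u v)) wins∁)

  ≔-independent-self : ∀ {u v} → u ≢ v → Independent (S ⟨ u ≔ v ⟩) u
  ≔-independent-self {u} {v} u≢v A = cong S (trans (forget true) (sym (forget false)))
    where
    forget : ∀ b → (A [ u ]≔ b) [ u ]≔ lookup (A [ u ]≔ b) v ≡ A [ u ]≔ lookup A v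
    forget b = trans (cong ((A [ u ]≔ b) [ u ]≔_) (lookup∘update′ (≢-sym u≢v) A b)) ([]≔-idempotent A u)

  ≔-independent : ∀ {t u v} → Independent S t → t ≢ u → t ≢ v → Independent (S ⟨ u ≔ v ⟩) t
  ≔-independent {t} {u} {v} ind t≢u t≢v A =
    trans (cong S (commute true)) (trans (ind _) (sym (cong S (commute false))))
    where
    commute : ∀ b → (A [ t ]≔ b) [ u ]≔ lookup (A [ t ]≔ b) v ≡ (A [ u ]≔ lookup A v) [ t ]≔ b
    commute b = trans (cong ((A [ t ]≔ b) [ u ]≔_) (lookup∘update′ (≢-sym t≢v) A b)) ([]≔-commutes A t u t≢u)

  ≔-reduct : IsGame S → ∀ {u v} → u ≢ v → Powerful S u → Powerful S v → Reduct S (S ⟨ u ≔ v ⟩)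
  ≔-reduct g {u} {v} u≢v u-powerful v-powerful =
    ≔-game g u v ,
    more-dummies
      (λ x dummy → independent⇒dummy (≔-independent (dummy⇒independent g dummy)
        (dummy⇒≢-powerful u-powerful dummy) (dummy⇒≢-powerful v-powerful dummy)))
      (independent⇒dummy (≔-independent-self u≢v)) u-powerful ,
    (λ st → ≔-strong st u v) , (λ si → ≔-simple si u v)

  ≔-either-invariant : IsGame S → ∀ A v w → (S ⟨ v ≔ w ⟩) A ≡ S A ⊎ (S ⟨ w ≔ v ⟩) A ≡ S A
  ≔-either-invariant g A v w with lookup A v in ev | lookup A w in ew
  ... | true  | true  = inj₁ (cong S ([]≔-unchanged A v ev))
  ... | false | false = inj₁ (cong S ([]≔-unchanged A v ev))
  ... | true  | false = ≤-sandwich (game-mono g ([]≔false-⊆ A v)) (game-mono g (⊆-[]≔true A w))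
  ... | false | true  = swap (≤-sandwich (game-mono g ([]≔false-⊆ A w)) (game-mono g (⊆-[]≔true A v)))

  ≔-median-agreeing : IsGame S → ∀ A u v w → lookup A u ≡ lookup A v →
    S A ≡ maj ((S ⟨ u ≔ v ⟩) A) ((S ⟨ v ≔ w ⟩) A) ((S ⟨ w ≔ u ⟩) A)
  ≔-median-agreeing g A u v w e = begin
    S A                                                       ≡⟨ sym (maj-absorb (≔-either-invariant g A v w)) ⟩
    maj (S A) ((S ⟨ v ≔ w ⟩) A) ((S ⟨ w ≔ v ⟩) A)             ≡⟨ cong₂ (λ x z → maj x ((S ⟨ v ≔ w ⟩) A) z)
                                                                   (sym (cong S ([]≔-unchanged A u e)))
                                                                   (cong (λ b → S (A [ w ]≔ b)) (sym e)) ⟩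
    maj ((S ⟨ u ≔ v ⟩) A) ((S ⟨ v ≔ w ⟩) A) ((S ⟨ w ≔ u ⟩) A) ∎
    where open ≡-Reasoning

  ≔-median : IsGame S → ∀ u v w → S ≐ median (S ⟨ u ≔ v ⟩) (S ⟨ v ≔ w ⟩) (S ⟨ w ≔ u ⟩)
  ≔-median g u v w A with two-of-three-agree (lookup A u) (lookup A v) (lookup A w)
  ... | inj₁ e        = ≔-median-agreeing g A u v w e
  ... | inj₂ (inj₁ e) = trans (≔-median-agreeing g A v w u e) (sym (maj-rotate ((S ⟨ u ≔ v ⟩) A) _ _))
  ... | inj₂ (inj₂ e) = trans (≔-median-agreeing g A w u v e) (maj-rotate ((S ⟨ w ≔ u ⟩) A) _ _)

dictator : Fin n → Family n
dictator v A = lookup A v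

constant : Bool → Family n
constant c _ = c

dictator-independent : ∀ {v t : Fin n} → v ≢ t → Independent (dictator v) t
dictator-independent v≢t A = trans (lookup∘update′ v≢t A true) (sym (lookup∘update′ v≢t A false))

dictator-reduct : IsGame S → ∀ {u v} → u ≢ v → Powerful S u → Powerful S v → Reduct S (dictator v)
dictator-reduct g {u} {v} u≢v u-powerful v-powerful =
  (λ A B A⊆B wins → []=⇒lookup (A⊆B (lookup⇒[]= v A wins))) ,
  more-dummies
    (λ x dummy → independent⇒dummy (dictator-independent (≢-sym (dummy⇒≢-powerful v-powerful dummy))))
    (independent⇒dummy (dictator-independent (≢-sym u≢v))) u-powerful ,
  (λ _ → strong) , (λ _ → simple)
  where
  strong : IsStrong (dictator v)
  strong A with lookup A v in e
  ... | true  = inj₁ refl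
  ... | false = inj₂ (trans (lookup-∁ A v) (cong not e))
  simple : IsSimple (dictator v)
  simple A (wins , wins∁) =
    contradiction (trans (sym (cong not wins)) (trans (sym (lookup-∁ A v)) wins∁)) λ ()

constant-reduct : ∀ {c z} → Powerful S z →
  (IsStrong S → c ≡ true) → (IsSimple S → c ≡ false) → Reduct S (constant c)
constant-reduct z-powerful c-strong c-simple =
  (λ _ _ _ wins → wins) ,
  more-dummies (λ _ _ → constant-dummy) constant-dummy z-powerful ,
  (λ st _ → inj₁ (c-strong st)) ,
  (λ si _ (wins , _) → contradiction (trans (sym (c-simple si)) wins) λ ())
  where
  constant-dummy : ∀ {x} → Dummy (constant _) x
  constant-dummy = independent⇒dummy (λ _ → refl)

-- Games with exactly two powerful voters

module TwoPowerful {S : Family n} (g : IsGame S) {u v : Fin n} (u≢v : u ≢ v)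
  (u-powerful : Powerful S u) (v-powerful : Powerful S v)
  (others-independent : ∀ t → t ≢ u → t ≢ v → Independent S t) where

  profile : Bool → Bool → Subset n
  profile a b = (∅ [ u ]≔ a) [ v ]≔ b

  lookup-profile-u : ∀ a b → lookup (profile a b) u ≡ a
  lookup-profile-u a b = trans (lookup∘update′ u≢v (∅ [ u ]≔ a) b) (lookup∘update u ∅ a)

  lookup-profile-v : ∀ a b → lookup (profile a b) v ≡ b
  lookup-profile-v a b = lookup∘update v (∅ [ u ]≔ a) b

  G : Bool → Bool → Bool
  G a b = S (profile a b)

  S≡G : ∀ A → S A ≡ G (lookup A u) (lookup A v)
  S≡G A = differ-only-on-independent⇒≡ S A _ independent
    where
    independent : ∀ t → lookup A t ≢ lookup (profile (lookup A u) (lookup A v)) t → Independent S t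
    independent t ne = others-independent t
      (λ { refl → ne (sym (lookup-profile-u _ _)) }) (λ { refl → ne (sym (lookup-profile-v _ _)) })

  u-essential : ¬ (∀ b → G false b ≡ G true b)
  u-essential G-ignores-u = u-powerful (independent⇒dummy λ A → begin
    S (A [ u ]≔ true)    ≡⟨ S≡G _ ⟩
    G _ _                ≡⟨ cong₂ G (lookup∘update u A true) (lookup∘update′ (≢-sym u≢v) A true) ⟩
    G true (lookup A v)  ≡⟨ sym (G-ignores-u _) ⟩
    G false (lookup A v) ≡⟨ sym (cong₂ G (lookup∘update u A false) (lookup∘update′ (≢-sym u≢v) A false)) ⟩
    G _ _                ≡⟨ sym (S≡G _) ⟩
    S (A [ u ]≔ false)   ∎)
    where open ≡-Reasoning

  v-essential : ¬ (∀ a → G a false ≡ G a true)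
  v-essential G-ignores-v = v-powerful (independent⇒dummy λ A → begin
    S (A [ v ]≔ true)    ≡⟨ S≡G _ ⟩
    G _ _                ≡⟨ cong₂ G (lookup∘update′ u≢v A true) (lookup∘update v A true) ⟩
    G (lookup A u) true  ≡⟨ sym (G-ignores-v _) ⟩
    G (lookup A u) false ≡⟨ sym (cong₂ G (lookup∘update′ u≢v A false) (lookup∘update v A false)) ⟩
    G _ _                ≡⟨ sym (S≡G _) ⟩
    S (A [ v ]≔ false)   ∎)
    where open ≡-Reasoning

  G≡maj : ∀ a b → G a b ≡ maj a b (G true false)
  G≡maj = monotone-essential⇒maj G
    (λ b → game-mono g ([]≔-mono-⊆ ([]≔-mono-⊆ ⊆-refl f≤t) b≤b))
    (λ a → game-mono g ([]≔-mono-⊆ ⊆-refl f≤t))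
    u-essential v-essential

  S∁≡G : S (∁ (profile true false)) ≡ G true false
  S∁≡G = begin
    S (∁ (profile true false)) ≡⟨ S≡G _ ⟩
    G _ _                      ≡⟨ cong₂ G (complement u (lookup-profile-u true false))
                                          (complement v (lookup-profile-v true false)) ⟩
    G false true               ≡⟨ G≡maj false true ⟩
    G true false               ∎
    where
    open ≡-Reasoning
    complement : ∀ x {b} → lookup (profile true false) x ≡ b → lookup (∁ (profile true false)) x ≡ not b
    complement x e = trans (lookup-∁ (profile true false) x) (cong not e)

  decomposition : MedianDecomposition S
  decomposition = median-decomposition
    (dictator-reduct g (≢-sym u≢v) v-powerful u-powerful)
    (dictator-reduct g u≢v u-powerful v-powerful)
    (constant-reduct u-powerful
      (λ st → [ id , trans (sym S∁≡G) ]′ (st (profile true false)))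
      (λ si → ¬-not (λ c≡true → si _ (c≡true , trans S∁≡G c≡true))))
    (λ A → trans (S≡G A) (G≡maj (lookup A u) (lookup A v)))

theorem2 : ∀ (n : ℕ) (S : Family n) → IsGame S
    → (∃[ u ] ∃[ v ] (u ≢ v × Powerful S u × Powerful S v))
    → ∃[ S₁ ] ∃[ S₂ ] ∃[ S₃ ]
        ( (IsGame S₁ × IsGame S₂ × IsGame S₃)
        × (S ≐ median S₁ S₂ S₃)
        × (MoreDummies S₁ S × MoreDummies S₂ S × MoreDummies S₃ S)
        × (IsStrong S → IsStrong S₁ × IsStrong S₂ × IsStrong S₃)
        × (IsSimple S → IsSimple S₁ × IsSimple S₂ × IsSimple S₃) )
theorem2 n S g (u , v , u≢v , u-powerful , v-powerful)
  with any? (λ w → ¬? (w ≟ u) ×-dec ¬? (w ≟ v) ×-dec ¬? (independent? S w))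
... | yes (w , w≢u , w≢v , w-dependent) =
  median-decomposition
    (≔-reduct g u≢v u-powerful v-powerful)
    (≔-reduct g (≢-sym w≢v) v-powerful w-powerful)
    (≔-reduct g w≢u w-powerful u-powerful)
    (≔-median g u v w)
  where
  w-powerful : Powerful S w
  w-powerful = w-dependent ∘ dummy⇒independent g
... | no ∄third = TwoPowerful.decomposition g u≢v u-powerful v-powerful
  λ t t≢u t≢v → decidable-stable (independent? S t) (λ t-dependent → ∄third (t , t≢u , t≢v , t-dependent))
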